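{- Let $S$ be a c-lattice and let $d(x)=(x\cdot 1_\pi)\|1_\sigma$, $d(S)=\{x\mid d(x)=x\}$, $\mathscr{S}(S)=\{x\mid x\le 1_\sigma\}$, $\mathscr{T}(S)=\{x\mid x\cdot 1_\pi=x\}$, $\mathscr{V}(S)=\{x\mid (x\cdot 1_\pi)\|U=x\}$, $\mathscr{N}(S)=\{x\mid x\cdot 0=0\}$. Then (1) $d(S)=\mathscr{S}(S)$; (2) $\mathscr{T}(S)=\{x\mid x\le 1_\pi\}=\{x\mid x\cdot 0=x\}$; (3) $\mathscr{V}(S)=\{x\mid d(x)\cdot U=x\}$; (4) $\mathscr{N}(S)=\{x\mid x\sqcap 1_\pi=0\}=\{x\mid x\le\overline{1}_\pi\}$.
   Context: A proto-trioid is $(S,+,\cdot,\|,0,1_\sigma,1_\pi)$ where $(S,+,0)$ is a join semilattice with least element $0$ (order $x\le y\iff x+y=y$); $1_\sigma\cdot x=x=x\cdot 1_\sigma$; $x\cdot y+x\cdot z\le x\cdot(y+z)$; $(x+y)\cdot z=x\cdot z+y\cdot z$; $0\cdot x=0$; $\|$ is associative and commutative with unit $1_\pi$, distributes over $+$, and $0\|x=0$. A c-lattice is a structure $(S,+,\sqcap,\cdot,\|,0,1_\sigma,1_\pi,U,\overline{1}_\pi)$ such that $(S,+,\sqcap,0,U)$ is a bounded distributive lattice with least element $0$ and greatest element $U$, $(S,+,\cdot,\|,0,1_\sigma,1_\pi)$ is a proto-trioid, and for all $x,y,z$: (cl1) $x\cdot 1_\pi+x\cdot\overline{1}_\pi=x\cdot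 U$; (cl2) $1_\pi\sqcap(x+\overline{1}_\pi)=x\cdot 0$; (cl3) $x\cdot(y\|z)\le(x\cdot y)\|(x\cdot z)$; (cl4) $z\|z\le z\Rightarrow (x\|y)\cdot z=(x\cdot z)\|(y\cdot z)$; (cl5) $x\cdot(y\cdot(z\cdot 0))=(x\cdot y)\cdot(z\cdot 0)$; (cl6) $(x\cdot 0)\cdot y=x\cdot(0\cdot y)$; (cl7) $1_\sigma\|1_\sigma=1_\sigma$; (cl8) $((x\cdot 1_\pi)\|1_\sigma)\cdot y=(x\cdot 1_\pi)\|y$; (cl9) $((x\sqcap 1_\sigma)\cdot 1_\pi)\|1_\sigma=x\sqcap 1_\sigma$; (cl10) $((x\sqcap\overline{1}_\pi)\cdot 1_\pi)\|1_\sigma=1_\sigma\sqcap((x\sqcap\overline{1}_\pi)\cdot\overline{1}_\pi)$; (cl11) $((x\sqcap\overline{1}_\pi)\cdot 1_\pi)\|\overline{1}_\pi=(x\sqcap\overline{1}_\pi)\cdot\overline{1}_\pi$. -}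

module Defs where

open import Level using (Level; suc; _⊔_)
open import Relation.Binary.PropositionalEquality using (_≡_)
open import Data.Product using (_×_)

record CLattice (a : Level) : Set (suc a) where
  infixr 6 _+_
  infixr 7 _⊓_
  infixr 8 _·_
  infixr 8 _∥_
  infix 4 _≤_
  field
    Carrier : Set a
    _+_ _⊓_ _·_ _∥_ : Carrier → Carrier → Carrier
    𝟘 1σ 1π U 1π̄ : Carrier

  _≤_ : Carrier → Carrier → Set a
  x ≤ y = x + y ≡ y

  field
    +-assoc : ∀ x y z → (x + y) + z ≡ x + (y + z)
    +-comm  : ∀ x y → x + y ≡ y + x
    +-idem  : ∀ x → x + x ≡ x
    ⊓-assoc : ∀ x y z → (x ⊓ y) ⊓ z ≡ x ⊓ (y ⊓ z)
    ⊓-comm  : ∀ x y → x ⊓ y ≡ y ⊓ x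
    ⊓-idem  : ∀ x → x ⊓ x ≡ x
    +-absorbs-⊓ : ∀ x y → x + (x ⊓ y) ≡ x
    ⊓-absorbs-+ : ∀ x y → x ⊓ (x + y) ≡ x
    ⊓-distribˡ-+ : ∀ x y z → x ⊓ (y + z) ≡ (x ⊓ y) + (x ⊓ z)
    +-identityˡ : ∀ x → 𝟘 + x ≡ x
    ⊓-identityˡ : ∀ x → U ⊓ x ≡ x
    ·-identityˡ : ∀ x → 1σ · x ≡ x
    ·-identityʳ : ∀ x → x · 1σ ≡ x
    ·-subdistribˡ : ∀ x y z → x · y + x · z ≤ x · (y + z)
    ·-distribʳ : ∀ x y z → (x + y) · z ≡ x · z + y · z
    ·-zeroˡ : ∀ x → 𝟘 · x ≡ 𝟘
    ∥-assoc : ∀ x y z → (x ∥ y) ∥ z ≡ x ∥ (y ∥ z)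
    ∥-comm  : ∀ x y → x ∥ y ≡ y ∥ x
    ∥-identityˡ : ∀ x → 1π ∥ x ≡ x
    ∥-distribˡ-+ : ∀ x y z → x ∥ (y + z) ≡ x ∥ y + x ∥ z
    ∥-zeroˡ : ∀ x → 𝟘 ∥ x ≡ 𝟘
    cl1 : ∀ x → x · 1π + x · 1π̄ ≡ x · U
    cl2 : ∀ x → 1π ⊓ (x + 1π̄) ≡ x · 𝟘
    cl3 : ∀ x y z → x · (y ∥ z) ≤ (x · y) ∥ (x · z)
    cl4 : ∀ x y z → z ∥ z ≤ z → (x ∥ y) · z ≡ (x · z) ∥ (y · z)
    cl5 : ∀ x y z → x · (y · (z · 𝟘)) ≡ (x · y) · (z · 𝟘)
    cl6 : ∀ x y → (x · 𝟘) · y ≡ x · (𝟘 · y)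
    cl7 : 1σ ∥ 1σ ≡ 1σ
    cl8 : ∀ x y → ((x · 1π) ∥ 1σ) · y ≡ (x · 1π) ∥ y
    cl9 : ∀ x → ((x ⊓ 1σ) · 1π) ∥ 1σ ≡ x ⊓ 1σ
    cl10 : ∀ x → ((x ⊓ 1π̄) · 1π) ∥ 1σ ≡ 1σ ⊓ ((x ⊓ 1π̄) · 1π̄)
    cl11 : ∀ x → ((x ⊓ 1π̄) · 1π) ∥ 1π̄ ≡ (x ⊓ 1π̄) · 1π̄

  d : Carrier → Carrier
  d x = (x · 1π) ∥ 1σ

_≐_ : ∀ {a ℓ₁ ℓ₂} {A : Set a} → (A → Set ℓ₁) → (A → Set ℓ₂) → Set (a ⊔ ℓ₁ ⊔ ℓ₂)
P ≐ Q = ∀ x → (P x → Q x) × (Q x → P x)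

module Submission where

-- In a c-lattice 1π̄ is the lattice complement of 1π (cl2 and cl1 at x = 𝟘 and
-- x = 1σ), and cl2 then says that x · 𝟘 is the meet x ⊓ 1π.  All four parts
-- follow from this description of x · 𝟘 together with cl5, cl6, cl8 and cl9.

open import Defs
open import Level using (Level)
open import Data.Product using (_×_; _,_)
open import Relation.Binary.PropositionalEquality
  using (_≡_; sym; trans; cong; cong₂; subst; module ≡-Reasoning)

module CLatticeProperties {a : Level} (S : CLattice a) where
  open CLattice S
  open ≡-Reasoning

  +-identityʳ : ∀ x → x + 𝟘 ≡ x
  +-identityʳ x = trans (+-comm x 𝟘) (+-identityˡ x)

  ⊓-identityʳ : ∀ x → x ⊓ U ≡ x
  ⊓-identityʳ x = trans (⊓-comm x U) (⊓-identityˡ x)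

  ⊓-zeroʳ : ∀ x → x ⊓ 𝟘 ≡ 𝟘
  ⊓-zeroʳ x = begin
    x ⊓ 𝟘        ≡⟨ ⊓-comm x 𝟘 ⟩
    𝟘 ⊓ x        ≡˘⟨ cong (𝟘 ⊓_) (+-identityˡ x) ⟩
    𝟘 ⊓ (𝟘 + x)  ≡⟨ ⊓-absorbs-+ 𝟘 x ⟩
    𝟘            ∎

  ≤⇒⊓≡ : ∀ {x y} → x ≤ y → x ⊓ y ≡ x
  ≤⇒⊓≡ {x} {y} x≤y = trans (cong (x ⊓_) (sym x≤y)) (⊓-absorbs-+ x y)

  ⊓≡⇒≤ : ∀ {x y} → x ⊓ y ≡ x → x ≤ y
  ⊓≡⇒≤ {x} {y} x⊓y≡x = begin
    x + y      ≡˘⟨ cong (_+ y) x⊓y≡x ⟩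
    x ⊓ y + y  ≡⟨ +-comm (x ⊓ y) y ⟩
    y + x ⊓ y  ≡⟨ cong (y +_) (⊓-comm x y) ⟩
    y + y ⊓ x  ≡⟨ +-absorbs-⊓ y x ⟩
    y          ∎

  x⊓y≤y : ∀ x y → x ⊓ y ≤ y
  x⊓y≤y x y = ⊓≡⇒≤ (trans (⊓-assoc x y y) (cong (x ⊓_) (⊓-idem y)))

  module _ {c c′ : Carrier} (c⊓c′≡𝟘 : c ⊓ c′ ≡ 𝟘) (c+c′≡U : c + c′ ≡ U) where

    ⊓-complement≡𝟘⇒≤ : ∀ {x} → x ⊓ c ≡ 𝟘 → x ≤ c′
    ⊓-complement≡𝟘⇒≤ {x} x⊓c≡𝟘 = ⊓≡⇒≤ (sym (begin
      x                ≡˘⟨ ⊓-identityʳ x ⟩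
      x ⊓ U            ≡˘⟨ cong (x ⊓_) c+c′≡U ⟩
      x ⊓ (c + c′)     ≡⟨ ⊓-distribˡ-+ x c c′ ⟩
      x ⊓ c + x ⊓ c′   ≡⟨ cong (_+ x ⊓ c′) x⊓c≡𝟘 ⟩
      𝟘 + x ⊓ c′       ≡⟨ +-identityˡ (x ⊓ c′) ⟩
      x ⊓ c′           ∎))

    ≤-complement⇒⊓≡𝟘 : ∀ {x} → x ≤ c′ → x ⊓ c ≡ 𝟘
    ≤-complement⇒⊓≡𝟘 {x} x≤c′ = begin
      x ⊓ c          ≡˘⟨ cong (_⊓ c) (≤⇒⊓≡ x≤c′) ⟩
      (x ⊓ c′) ⊓ c   ≡⟨ ⊓-assoc x c′ c ⟩
      x ⊓ (c′ ⊓ c)   ≡⟨ cong (x ⊓_) (trans (⊓-comm c′ c) c⊓c′≡𝟘) ⟩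
      x ⊓ 𝟘          ≡⟨ ⊓-zeroʳ x ⟩
      𝟘              ∎

  ∥-monoˡ-≤ : ∀ {x y} z → x ≤ y → x ∥ z ≤ y ∥ z
  ∥-monoˡ-≤ {x} {y} z x≤y = begin
    x ∥ z + y ∥ z  ≡⟨ cong₂ _+_ (∥-comm x z) (∥-comm y z) ⟩
    z ∥ x + z ∥ y  ≡˘⟨ ∥-distribˡ-+ z x y ⟩
    z ∥ (x + y)    ≡⟨ cong (z ∥_) x≤y ⟩
    z ∥ y          ≡⟨ ∥-comm z y ⟩
    y ∥ z          ∎

  1π⊓1π̄≡𝟘 : 1π ⊓ 1π̄ ≡ 𝟘
  1π⊓1π̄≡𝟘 = begin
    1π ⊓ 1π̄         ≡˘⟨ cong (1π ⊓_) (+-identityˡ 1π̄) ⟩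
    1π ⊓ (𝟘 + 1π̄)   ≡⟨ cl2 𝟘 ⟩
    𝟘 · 𝟘           ≡⟨ ·-zeroˡ 𝟘 ⟩
    𝟘               ∎

  1π+1π̄≡U : 1π + 1π̄ ≡ U
  1π+1π̄≡U = begin
    1π + 1π̄             ≡˘⟨ cong₂ _+_ (·-identityˡ 1π) (·-identityˡ 1π̄) ⟩
    1σ · 1π + 1σ · 1π̄   ≡⟨ cl1 1σ ⟩
    1σ · U              ≡⟨ ·-identityˡ U ⟩
    U                   ∎

  x·𝟘≡x⊓1π : ∀ x → x · 𝟘 ≡ x ⊓ 1π
  x·𝟘≡x⊓1π x = begin
    x · 𝟘                 ≡˘⟨ cl2 x ⟩
    1π ⊓ (x + 1π̄)         ≡⟨ ⊓-distribˡ-+ 1π x 1π̄ ⟩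
    1π ⊓ x + 1π ⊓ 1π̄      ≡⟨ cong (1π ⊓ x +_) 1π⊓1π̄≡𝟘 ⟩
    1π ⊓ x + 𝟘            ≡⟨ +-identityʳ (1π ⊓ x) ⟩
    1π ⊓ x                ≡⟨ ⊓-comm 1π x ⟩
    x ⊓ 1π                ∎

  ≤1π⇒·𝟘≡ : ∀ {x} → x ≤ 1π → x · 𝟘 ≡ x
  ≤1π⇒·𝟘≡ {x} x≤1π = trans (x·𝟘≡x⊓1π x) (≤⇒⊓≡ x≤1π)

  ·𝟘≡⇒≤1π : ∀ {x} → x · 𝟘 ≡ x → x ≤ 1π
  ·𝟘≡⇒≤1π {x} x·𝟘≡x = ⊓≡⇒≤ (trans (sym (x·𝟘≡x⊓1π x)) x·𝟘≡x)

  x·1π·𝟘≡x·1π : ∀ x → (x · 1π) · 𝟘 ≡ x · 1π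
  x·1π·𝟘≡x·1π x = begin
    (x · 1π) · 𝟘         ≡˘⟨ cong ((x · 1π) ·_) (·-identityˡ 𝟘) ⟩
    (x · 1π) · (1σ · 𝟘)  ≡˘⟨ cl5 x 1π 1σ ⟩
    x · (1π · (1σ · 𝟘))  ≡⟨ cong (λ t → x · (1π · t)) (·-identityˡ 𝟘) ⟩
    x · (1π · 𝟘)         ≡⟨ cong (x ·_) (trans (x·𝟘≡x⊓1π 1π) (⊓-idem 1π)) ⟩
    x · 1π               ∎

  x·1π≤1π : ∀ x → x · 1π ≤ 1π
  x·1π≤1π x = subst (_≤ 1π) (trans (sym (x·𝟘≡x⊓1π (x · 1π))) (x·1π·𝟘≡x·1π x))
                    (x⊓y≤y (x · 1π) 1π)

  d≤1σ : ∀ x → d x ≤ 1σ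
  d≤1σ x = subst (d x ≤_) (∥-identityˡ 1σ) (∥-monoˡ-≤ 1σ (x·1π≤1π x))

  d-fixed≐≤1σ : (λ x → d x ≡ x) ≐ (λ x → x ≤ 1σ)
  d-fixed≐≤1σ x = (λ dx≡x → subst (_≤ 1σ) dx≡x (d≤1σ x))
                , (λ x≤1σ → subst (λ y → d y ≡ y) (≤⇒⊓≡ x≤1σ) (cl9 x))

  ·1π-fixed≐≤1π : (λ x → x · 1π ≡ x) ≐ (λ x → x ≤ 1π)
  ·1π-fixed≐≤1π x = (λ x·1π≡x → subst (_≤ 1π) x·1π≡x (x·1π≤1π x))
                  , (λ x≤1π → x·1π≡x (≤1π⇒·𝟘≡ x≤1π))
    where
    x·1π≡x : x · 𝟘 ≡ x → x · 1π ≡ x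
    x·1π≡x x·𝟘≡x = begin
      x · 1π        ≡˘⟨ cong (_· 1π) x·𝟘≡x ⟩
      (x · 𝟘) · 1π  ≡⟨ cl6 x 1π ⟩
      x · (𝟘 · 1π)  ≡⟨ cong (x ·_) (·-zeroˡ 1π) ⟩
      x · 𝟘         ≡⟨ x·𝟘≡x ⟩
      x             ∎

lemma22 : ∀ {a : Level} (S : CLattice a) → let open CLattice S in
    ((λ x → d x ≡ x) ≐ (λ x → x ≤ 1σ))
    × (((λ x → x · 1π ≡ x) ≐ (λ x → x ≤ 1π)) × ((λ x → x ≤ 1π) ≐ (λ x → x · 𝟘 ≡ x)))
    × ((λ x → (x · 1π) ∥ U ≡ x) ≐ (λ x → d x · U ≡ x))
    × (((λ x → x · 𝟘 ≡ 𝟘) ≐ (λ x → x ⊓ 1π ≡ 𝟘)) × ((λ x → x ⊓ 1π ≡ 𝟘) ≐ (λ x → x ≤ 1π̄)))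
lemma22 S =
    d-fixed≐≤1σ
  , (·1π-fixed≐≤1π , λ x → ≤1π⇒·𝟘≡ , ·𝟘≡⇒≤1π)
  , (λ x → trans (cl8 x U) , trans (sym (cl8 x U)))
  , ( (λ x → trans (sym (x·𝟘≡x⊓1π x)) , trans (x·𝟘≡x⊓1π x))
    , (λ x → ⊓-complement≡𝟘⇒≤ 1π⊓1π̄≡𝟘 1π+1π̄≡U , ≤-complement⇒⊓≡𝟘 1π⊓1π̄≡𝟘 1π+1π̄≡U))
  where open CLattice S
        open CLatticeProperties S
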